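{- Suppose there exists a PS$(v)$ or an APS$(v,\alpha,\beta)$ (for some nonzero $\alpha,\beta\in\mathbb{Z}_v$). Then (1) there exists a maximum $(3v,4,1)$-OOC whenever $\gcd(v,6)=1$, and (2) there exists a maximum $(5v,5,1)$-OOC whenever $\gcd(v,10)=1$.
   Context: PS$(v)$ ($v\equiv1\pmod4$): a set $\mathcal S$ of $(v-1)/4$ unordered pairs from $\mathbb{Z}_v$ with $\bigcup_{\{x,y\}\in\mathcal S}\pm\{x,y\}=\mathbb{Z}_v\setminus\{0\}$ and $\bigcup_{\{x,y\}\in\mathcal S}\pm\{x-y,x+y\}=\mathbb{Z}_v\setminus\{0\}$. APS$(v,\alpha,\beta)$ ($v\equiv 3\pmod 4$, $\alpha,\beta\ne0$): a set $\mathcal S$ of $(v-3)/4$ unordered pairs from $\mathbb{Z}_v$ with $\bigcup\pm\{x,y\}=\mathbb{Z}_v\setminus\{0,\pm\alpha\}$ and $\bigcup\pm\{x-y,x+y\}=\mathbb{Z}_v\setminus\{0,\pm\beta\}$. A $(n,k,1)$-optical orthogonal code (OOC) is a set $\mathcal B$ of $k$-subsets (codewords) of $\mathbb{Z}_n$ such that the multiset $\Delta\mathcal B=\bigcup_{B\in\mathcal B}[x-y: x,y\in B, x\ne y]$ has no repeated elements; it is maximum if $|\mathbb{Z}_n\setminus\Delta\mathcal B|\le k(k-1)$. -}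

module Defs where

open import Data.Nat using (ℕ; zero; suc; _+_; _*_; _∸_; _<_; _≤_; _≡ᵇ_)
open import Data.Nat.DivMod using (_%_; _/_)
open import Data.Nat.Properties using (_≟_)
open import Data.Bool using (if_then_else_)
open import Data.List using (List; []; _∷_; _++_; concatMap; length; filter; upTo)
open import Data.List.Relation.Unary.All using (All)
open import Data.List.Relation.Unary.Unique.Propositional using (Unique)
open import Data.List.Membership.Propositional using (_∈_)
open import Data.List.Membership.DecPropositional _≟_ using (_∈?_)
open import Data.Product using (Σ; _×_; _,_)
open import Function.Bundles using (_⇔_)
open import Relation.Binary.PropositionalEquality using (_≡_; _≢_)
open import Relation.Nullary using (¬?)

-- Arithmetic in ℤ_n, elements represented by naturals 0..n-1.
-- (For n = 0 the reduction is the identity; never used, since all moduli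
-- in the theorem are positive.)
_mod_ : ℕ → ℕ → ℕ
x mod zero  = x
x mod suc m = x % suc m

negM : ℕ → ℕ → ℕ
negM n x = (n ∸ (x mod n)) mod n

addM : ℕ → ℕ → ℕ → ℕ
addM n x y = (x + y) mod n

subM : ℕ → ℕ → ℕ → ℕ
subM n x y = (x + negM n y) mod n

pmPair : ℕ → ℕ × ℕ → List ℕ
pmPair n (x , y) = x ∷ negM n x ∷ y ∷ negM n y ∷ []

pmDiffSum : ℕ → ℕ × ℕ → List ℕ
pmDiffSum n (x , y) = pmPair n (subM n x y , addM n x y)

unionPair : ℕ → List (ℕ × ℕ) → List ℕ
unionPair n S = concatMap (pmPair n) S

unionDiffSum : ℕ → List (ℕ × ℕ) → List ℕ
unionDiffSum n S = concatMap (pmDiffSum n) S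

IsPS : ℕ → List (ℕ × ℕ) → Set
IsPS v S =
  (v % 4 ≡ 1) ×
  (length S ≡ (v ∸ 1) / 4) ×
  (∀ z → (z ∈ unionPair v S) ⇔ (z < v × z ≢ 0)) ×
  (∀ z → (z ∈ unionDiffSum v S) ⇔ (z < v × z ≢ 0))

PS : ℕ → Set
PS v = Σ (List (ℕ × ℕ)) λ S → IsPS v S

IsAPS : ℕ → ℕ → ℕ → List (ℕ × ℕ) → Set
IsAPS v α β S =
  (v % 4 ≡ 3) ×
  (α < v) × (α ≢ 0) × (β < v) × (β ≢ 0) ×
  (length S ≡ (v ∸ 3) / 4) ×
  (∀ z → (z ∈ unionPair v S) ⇔ (z < v × z ≢ 0 × z ≢ α × z ≢ negM v α)) ×
  (∀ z → (z ∈ unionDiffSum v S) ⇔ (z < v × z ≢ 0 × z ≢ β × z ≢ negM v β))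

APS : ℕ → ℕ → ℕ → Set
APS v α β = Σ (List (ℕ × ℕ)) λ S → IsAPS v α β S

diffs : ℕ → List ℕ → List ℕ
diffs n C = concatMap (λ x → concatMap (λ y → if x ≡ᵇ y then [] else (subM n x y ∷ [])) C) C

Δ : ℕ → List (List ℕ) → List ℕ
Δ n B = concatMap (diffs n) B

IsOOC : ℕ → ℕ → List (List ℕ) → Set
IsOOC n k B =
  All (λ C → (length C ≡ k) × Unique C × All (λ x → x < n) C) B ×
  Unique (Δ n B)

missing : ℕ → List (List ℕ) → ℕ
missing n B = length (filter (λ z → ¬? (z ∈? Δ n B)) (upTo n))

IsMaxOOC : ℕ → ℕ → List (List ℕ) → Set
IsMaxOOC n k B = IsOOC n k B × (missing n B ≤ k * (k ∸ 1))

-- Write v = 4s + 1 + 2δ with s the number of pairs and δ ∈ {0, 1}, and residues of ℤ_{kv}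
-- (k = 3, 5) in base k as r + kq with a digit r < k and q ∈ ℤ_v. A pair {x, y} gives the codeword
-- {0, 3(x+y), 1+3x, 1+3y}, resp. {0, 5(2x), 1+5x, 2+5(x+y), 2+5(x-y)}; a difference of two of its
-- elements has digit r₁ - r₂ and high part one of ±x, ±y, ±(x+y), ±(x-y), or ±2x, ±2y. By the
-- defining unions of the PS/APS every residue with digit at most k/2 is therefore a difference,
-- except those in a set M of at most k(k-1) residues (multiples of 5 are reached by halving, v being
-- odd); the larger digits follow by negation. As there are only s·k(k-1) = kv - |M| differences,
-- none of them repeats.

module Submission where

open import Defs
open import Data.Nat using (ℕ; zero; suc; NonZero; _+_; _*_; _∸_; _≤_; _<_; _≤?_; _%_; _/_; _≡ᵇ_; z≤n; s≤s; z<s)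
open import Data.Nat.Properties
open import Data.Nat.DivMod using (m≡m%n+[m/n]*n; m%n<n; m<n⇒m%n≡m; [m+kn]%n≡m%n; m<n*o⇒m/o<n; m*n/n≡m)
open import Data.Nat.GCD using (gcd)
open import Data.Nat.Tactic.RingSolver using (solve-∀)
import Data.Integer as ℤ
import Data.Integer.Properties as ℤₚ
import Data.Integer.Tactic.RingSolver as ℤ-Solver
open import Data.Bool using (true; false; T; if_then_else_)
open import Data.List using (List; []; _∷_; _++_; map; concatMap; length; filter; upTo)
open import Data.List.Properties using (length-map; length-++; length-upTo; filter-all; filter-notAll)
open import Data.List.Relation.Unary.All as All using (All; []; _∷_)
open import Data.List.Relation.Unary.All.Properties using (map⁺; ¬Any⇒All¬)
open import Data.List.Relation.Unary.AllPairs using (AllPairs; []; _∷_)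
open import Data.List.Relation.Unary.Any as Any using (here; there)
open import Data.List.Relation.Unary.Unique.Propositional using (Unique)
open import Data.List.Relation.Unary.Unique.Propositional.Properties using (filter⁺; upTo⁺)
open import Data.List.Membership.Propositional using (_∈_; _∉_; find; lose)
open import Data.List.Membership.Propositional.Properties
  using (∈-map⁺; ∈-++⁺ˡ; ∈-++⁺ʳ; ∈-concatMap⁺; ∈-concatMap⁻; ∈-filter⁺; ∈-filter⁻; ∈-upTo⁻)
open import Data.List.Membership.DecPropositional _≟_ using (_∈?_)
open import Data.List.Relation.Binary.Subset.Propositional using (_⊆_)
open import Data.Product using (Σ; ∃; ∃₂; _×_; _,_; proj₁; proj₂)
open import Data.Sum using (_⊎_; inj₁; inj₂)
open import Data.Unit using (tt)
open import Data.Empty using (⊥-elim)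
open import Function.Bundles using (Equivalence)
open import Level using (0ℓ)
open import Relation.Nullary using (yes; no; contradiction)
open import Relation.Nullary.Decidable using (¬?)
open import Relation.Unary using (Pred; Decidable)
open import Relation.Unary.Properties using (∁?)
open import Relation.Binary.Bundles using (Setoid)
open import Relation.Binary.Definitions using (DecidableEquality)
open import Relation.Binary.PropositionalEquality
  using (_≡_; _≢_; refl; sym; trans; cong; cong₂; subst; ≢-sym; module ≡-Reasoning)
import Relation.Binary.Reasoning.Setoid as SetoidReasoning

-- Pigeonhole and counting

module Pigeonhole {A : Set} (_≟ᴬ_ : DecidableEquality A) where

  private
    without : A → List A → List A
    without a = filter (λ x → ¬? (x ≟ᴬ a))

    ∈-without⁺ : ∀ {a x xs} → x ∈ xs → x ≢ a → x ∈ without a xs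
    ∈-without⁺ = ∈-filter⁺ (λ x → ¬? (x ≟ᴬ _))

    ∈-without⁻ : ∀ {a x xs} → x ∈ without a xs → x ∈ xs × x ≢ a
    ∈-without⁻ {a} = ∈-filter⁻ (λ x → ¬? (x ≟ᴬ a))

    length-without-∈ : ∀ {a xs} → a ∈ xs → suc (length (without a xs)) ≤ length xs
    length-without-∈ {a} a∈xs = filter-notAll (λ x → ¬? (x ≟ᴬ a)) _ (Any.map (λ { refl x≢a → x≢a refl }) a∈xs)

    length-without-Unique : ∀ a {xs} → Unique xs → length xs ≤ suc (length (without a xs))
    length-without-Unique a {[]}     []          = z≤n
    length-without-Unique a {x ∷ xs} (x∉xs ∷ u) with x ≟ᴬ a
    ... | yes refl = s≤s (≤-reflexive (cong length (sym
                       (filter-all (λ x → ¬? (x ≟ᴬ a)) (All.map (λ a≢y y≡a → a≢y (sym y≡a)) x∉xs)))))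
    ... | no _     = s≤s (length-without-Unique a u)

  Unique-⊆⇒length≤ : ∀ {xs ys} → Unique xs → xs ⊆ ys → length xs ≤ length ys
  Unique-⊆⇒length≤ {[]}     _           _     = z≤n
  Unique-⊆⇒length≤ {x ∷ xs} (x∉xs ∷ u) xs⊆ys = ≤-trans
    (s≤s (Unique-⊆⇒length≤ u (λ p → ∈-without⁺ (xs⊆ys (there p)) (λ eq → All.lookup x∉xs p (sym eq)))))
    (length-without-∈ (xs⊆ys (here refl)))

  Unique-⊆-length≥⇒Unique : ∀ {xs ys} → Unique xs → xs ⊆ ys → length ys ≤ length xs → Unique ys
  Unique-⊆-length≥⇒Unique {ys = []}     _ _     _         = []
  Unique-⊆-length≥⇒Unique {xs} {y ∷ ys} u xs⊆ys |ys|≤|xs| =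
    ¬Any⇒All¬ ys y∉ys ∷ Unique-⊆-length≥⇒Unique (filter⁺ (λ x → ¬? (x ≟ᴬ y)) u) xs∖y⊆ys
      (≤-pred (≤-trans |ys|≤|xs| (length-without-Unique y u)))
    where
    xs∖y⊆ys : without y xs ⊆ ys
    xs∖y⊆ys p with p′ , x≢y ← ∈-without⁻ p with xs⊆ys p′
    ... | here x≡y = ⊥-elim (x≢y x≡y)
    ... | there q  = q
    y∉ys : y ∉ ys
    y∉ys y∈ys = <-irrefl refl (≤-trans (s≤s (Unique-⊆⇒length≤ u xs⊆ys′)) |ys|≤|xs|)
      where
      xs⊆ys′ : xs ⊆ ys
      xs⊆ys′ p with xs⊆ys p
      ... | here refl = y∈ys
      ... | there q   = q

open Pigeonhole _≟_

length-filter+length-filter-∁ : ∀ {A : Set} {P : Pred A 0ℓ} (P? : Decidable P) xs →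
  length (filter P? xs) + length (filter (∁? P?) xs) ≡ length xs
length-filter+length-filter-∁ P? []       = refl
length-filter+length-filter-∁ P? (x ∷ xs) with P? x
... | yes _ = cong suc (length-filter+length-filter-∁ P? xs)
... | no _  = trans (+-suc _ _) (cong suc (length-filter+length-filter-∁ P? xs))

-- Pigeonhole: the differences cover the residues outside M, and there are no more of them.
covering⇒IsMaxOOC : ∀ n k B (M : List ℕ) →
  All (λ C → (length C ≡ k) × Unique C × All (_< n) C) B →
  (∀ z → z < n → z ∉ M → z ∈ Δ n B) →
  length (Δ n B) + length M ≤ n → length M ≤ k * (k ∸ 1) → IsMaxOOC n k B
covering⇒IsMaxOOC n k B M codewords covers |Δ|+|M|≤n |M|≤k[k-1] =
  (codewords , Unique-⊆-length≥⇒Unique (filter⁺ _ (upTo⁺ n)) outside⊆Δ |Δ|≤|outside|) ,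
  ≤-trans (Unique-⊆⇒length≤ (filter⁺ _ (upTo⁺ n)) missed⊆M) |M|≤k[k-1]
  where
  outside inside : List ℕ
  outside = filter (λ z → ¬? (z ∈? M)) (upTo n)
  inside  = filter (_∈? M) (upTo n)

  outside⊆Δ : outside ⊆ Δ n B
  outside⊆Δ z∈ with z<n , z∉M ← ∈-filter⁻ (λ z → ¬? (z ∈? M)) z∈ = covers _ (∈-upTo⁻ z<n) z∉M

  inside⊆M : inside ⊆ M
  inside⊆M z∈ = proj₂ (∈-filter⁻ (_∈? M) {xs = upTo n} z∈)

  |Δ|≤|outside| : length (Δ n B) ≤ length outside
  |Δ|≤|outside| = +-cancelʳ-≤ (length M) _ _ (begin
    length (Δ n B) + length M          ≤⟨ |Δ|+|M|≤n ⟩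
    n                                  ≡⟨ length-upTo n ⟨
    length (upTo n)                    ≡⟨ length-filter+length-filter-∁ (_∈? M) (upTo n) ⟨
    length inside + length outside     ≡⟨ +-comm (length inside) _ ⟩
    length outside + length inside     ≤⟨ +-monoʳ-≤ (length outside) (Unique-⊆⇒length≤ (filter⁺ _ (upTo⁺ n)) inside⊆M) ⟩
    length outside + length M          ∎)
    where open ≤-Reasoning

  missed⊆M : filter (λ z → ¬? (z ∈? Δ n B)) (upTo n) ⊆ M
  missed⊆M {z} z∈ with z<n , z∉Δ ← ∈-filter⁻ (λ z → ¬? (z ∈? Δ n B)) z∈ with z ∈? M
  ... | yes z∈M = z∈M
  ... | no  z∉M = contradiction (covers z (∈-upTo⁻ z<n) z∉M) z∉Δ

-- Congruences of integers and arithmetic in ℤ_n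

infix 4 _≡_[mod_]
record _≡_[mod_] (i j : ℤ.ℤ) (n : ℕ) : Set where
  constructor with-quotient
  field
    quotient : ℤ.ℤ
    equation : i ≡ j ℤ.+ quotient ℤ.* ℤ.+ n

private
  shift-sym : ∀ j q n → j ≡ (j ℤ.+ q ℤ.* n) ℤ.+ (ℤ.- q) ℤ.* n
  shift-sym = ℤ-Solver.solve-∀
  shift-trans : ∀ k p q n → (k ℤ.+ q ℤ.* n) ℤ.+ p ℤ.* n ≡ k ℤ.+ (p ℤ.+ q) ℤ.* n
  shift-trans = ℤ-Solver.solve-∀
  shift-+ : ∀ j j′ p q n → (j ℤ.+ p ℤ.* n) ℤ.+ (j′ ℤ.+ q ℤ.* n) ≡ (j ℤ.+ j′) ℤ.+ (p ℤ.+ q) ℤ.* n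
  shift-+ = ℤ-Solver.solve-∀
  shift-neg : ∀ j q n → ℤ.- (j ℤ.+ q ℤ.* n) ≡ ℤ.- j ℤ.+ (ℤ.- q) ℤ.* n
  shift-neg = ℤ-Solver.solve-∀
  shift-* : ∀ c j q n → c ℤ.* (j ℤ.+ q ℤ.* n) ≡ c ℤ.* j ℤ.+ (c ℤ.* q) ℤ.* n
  shift-* = ℤ-Solver.solve-∀
  shift-scale : ∀ k j q n → k ℤ.* (j ℤ.+ q ℤ.* n) ≡ k ℤ.* j ℤ.+ q ℤ.* (k ℤ.* n)
  shift-scale = ℤ-Solver.solve-∀

≡⇒≡[mod] : ∀ {n i j} → i ≡ j → i ≡ j [mod n ]
≡⇒≡[mod] {j = j} refl = with-quotient ℤ.0ℤ (sym (ℤₚ.+-identityʳ j))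

≡[mod]-refl : ∀ {n i} → i ≡ i [mod n ]
≡[mod]-refl = ≡⇒≡[mod] refl

≡[mod]-sym : ∀ {n i j} → i ≡ j [mod n ] → j ≡ i [mod n ]
≡[mod]-sym {n} {j = j} (with-quotient q refl) = with-quotient (ℤ.- q) (shift-sym j q (ℤ.+ n))

≡[mod]-trans : ∀ {n i j k} → i ≡ j [mod n ] → j ≡ k [mod n ] → i ≡ k [mod n ]
≡[mod]-trans {n} {k = k} (with-quotient p refl) (with-quotient q refl) =
  with-quotient (p ℤ.+ q) (shift-trans k p q (ℤ.+ n))

≡[mod]-setoid : ℕ → Setoid 0ℓ 0ℓ
≡[mod]-setoid n = record
  { Carrier       = ℤ.ℤ
  ; _≈_           = _≡_[mod n ]
  ; isEquivalence = record { refl = ≡[mod]-refl ; sym = ≡[mod]-sym ; trans = ≡[mod]-trans }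
  }

module ≡[mod]-Reasoning (n : ℕ) = SetoidReasoning (≡[mod]-setoid n)

+-cong-≡[mod] : ∀ {n i j i′ j′} → i ≡ j [mod n ] → i′ ≡ j′ [mod n ] → i ℤ.+ i′ ≡ j ℤ.+ j′ [mod n ]
+-cong-≡[mod] {n} {j = j} {j′ = j′} (with-quotient p refl) (with-quotient q refl) =
  with-quotient (p ℤ.+ q) (shift-+ j j′ p q (ℤ.+ n))

+-congˡ-≡[mod] : ∀ {n j k} i → j ≡ k [mod n ] → i ℤ.+ j ≡ i ℤ.+ k [mod n ]
+-congˡ-≡[mod] i = +-cong-≡[mod] (≡[mod]-refl {i = i})

-‿cong-≡[mod] : ∀ {n i j} → i ≡ j [mod n ] → ℤ.- i ≡ ℤ.- j [mod n ]
-‿cong-≡[mod] {n} {j = j} (with-quotient q refl) = with-quotient (ℤ.- q) (shift-neg j q (ℤ.+ n))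

-‿+-cong-≡[mod] : ∀ {n i j i′ j′} → i ≡ j [mod n ] → i′ ≡ j′ [mod n ] → i ℤ.- i′ ≡ j ℤ.- j′ [mod n ]
-‿+-cong-≡[mod] i≡j i′≡j′ = +-cong-≡[mod] i≡j (-‿cong-≡[mod] i′≡j′)

*-congˡ-≡[mod] : ∀ {n i j} c → i ≡ j [mod n ] → c ℤ.* i ≡ c ℤ.* j [mod n ]
*-congˡ-≡[mod] {n} {j = j} c (with-quotient q refl) = with-quotient (c ℤ.* q) (shift-* c j q (ℤ.+ n))

*-scale-≡[mod] : ∀ {n i j} k → i ≡ j [mod n ] → ℤ.+ k ℤ.* i ≡ ℤ.+ k ℤ.* j [mod k * n ]
*-scale-≡[mod] {n} {j = j} k (with-quotient q refl) =
  with-quotient q (trans (shift-scale (ℤ.+ k) j q (ℤ.+ n))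
                         (cong (λ m → ℤ.+ k ℤ.* j ℤ.+ q ℤ.* m) (sym (ℤₚ.pos-* k n))))

private
  no-wrap-around : ∀ {n i j r} → i < n → ℤ.+ i ≢ ℤ.+ j ℤ.+ ℤ.+[1+ r ] ℤ.* ℤ.+ n
  no-wrap-around {n} {i} {j} {r} i<n eq = <-irrefl refl (<-≤-trans i<n (begin
    n                 ≤⟨ m≤m+n n (r * n) ⟩
    suc r * n         ≤⟨ m≤n+m _ j ⟩
    j + suc r * n     ≡⟨ ℤₚ.+-injective (trans pos-[j+[1+r]n] (sym eq)) ⟩
    i                 ∎))
    where
    open ≤-Reasoning
    pos-[j+[1+r]n] : ℤ.+ (j + suc r * n) ≡ ℤ.+ j ℤ.+ ℤ.+[1+ r ] ℤ.* ℤ.+ n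
    pos-[j+[1+r]n] = trans (ℤₚ.pos-+ j _) (cong (λ m → ℤ.+ j ℤ.+ m) (ℤₚ.pos-* (suc r) n))

≡[mod]⇒≡ : ∀ {n i j} → i < n → j < n → ℤ.+ i ≡ ℤ.+ j [mod n ] → i ≡ j
≡[mod]⇒≡ {j = j} _ _ (with-quotient (ℤ.+ 0) eq) = trans (ℤₚ.+-injective eq) (+-identityʳ j)
≡[mod]⇒≡ i<n _ (with-quotient ℤ.+[1+ r ] eq) = ⊥-elim (no-wrap-around {r = r} i<n eq)
≡[mod]⇒≡ {n} {j = j} _ j<n (with-quotient ℤ.-[1+ r ] eq) = ⊥-elim (no-wrap-around {r = r} j<n
  (trans (shift-sym (ℤ.+ j) ℤ.-[1+ r ] (ℤ.+ n)) (cong (λ m → m ℤ.+ ℤ.+[1+ r ] ℤ.* ℤ.+ n) (sym eq))))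

pos-∸ : ∀ {a b} → b ≤ a → ℤ.+ (a ∸ b) ≡ ℤ.+ a ℤ.- ℤ.+ b
pos-∸ {a} {b} b≤a = trans (sym (ℤₚ.⊖-≥ b≤a)) (sym (ℤₚ.m-n≡m⊖n a b))

mod-≡[mod] : ∀ n .{{_ : NonZero n}} i → ℤ.+ (i mod n) ≡ ℤ.+ i [mod n ]
mod-≡[mod] n@(suc _) i = ≡[mod]-sym (with-quotient (ℤ.+ (i / n)) (trans (cong ℤ.+_ (m≡m%n+[m/n]*n i n))
  (trans (ℤₚ.pos-+ (i % n) _) (cong (λ m → ℤ.+ (i % n) ℤ.+ m) (ℤₚ.pos-* (i / n) n)))))

mod< : ∀ n .{{_ : NonZero n}} i → i mod n < n
mod< n@(suc _) i = m%n<n i n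

addM-≡[mod] : ∀ n .{{_ : NonZero n}} a b → ℤ.+ addM n a b ≡ ℤ.+ a ℤ.+ ℤ.+ b [mod n ]
addM-≡[mod] n a b = ≡[mod]-trans (mod-≡[mod] n (a + b)) (≡⇒≡[mod] (ℤₚ.pos-+ a b))

negM-≡[mod] : ∀ n .{{_ : NonZero n}} a → ℤ.+ negM n a ≡ ℤ.- ℤ.+ a [mod n ]
negM-≡[mod] n a = begin
  ℤ.+ negM n a                   ≈⟨ mod-≡[mod] n _ ⟩
  ℤ.+ (n ∸ a mod n)              ≡⟨ pos-∸ (<⇒≤ (mod< n a)) ⟩
  ℤ.+ n ℤ.- ℤ.+ (a mod n)        ≈⟨ -‿+-cong-≡[mod] n≡0 (mod-≡[mod] n a) ⟩
  ℤ.0ℤ ℤ.- ℤ.+ a                 ≡⟨ ℤₚ.+-identityˡ (ℤ.- ℤ.+ a) ⟩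
  ℤ.- ℤ.+ a                      ∎
  where
  open ≡[mod]-Reasoning n
  n≡0 : ℤ.+ n ≡ ℤ.0ℤ [mod n ]
  n≡0 = with-quotient (ℤ.+ 1) (sym (trans (ℤₚ.+-identityˡ _) (ℤₚ.*-identityˡ (ℤ.+ n))))

subM-≡[mod] : ∀ n .{{_ : NonZero n}} a b → ℤ.+ subM n a b ≡ ℤ.+ a ℤ.- ℤ.+ b [mod n ]
subM-≡[mod] n a b = begin
  ℤ.+ subM n a b              ≈⟨ mod-≡[mod] n _ ⟩
  ℤ.+ (a + negM n b)          ≡⟨ ℤₚ.pos-+ a _ ⟩
  ℤ.+ a ℤ.+ ℤ.+ negM n b      ≈⟨ +-congˡ-≡[mod] (ℤ.+ a) (negM-≡[mod] n b) ⟩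
  ℤ.+ a ℤ.- ℤ.+ b             ∎
  where open ≡[mod]-Reasoning n

-- Expressions in two variables, read in ℤ_n through the canonical representatives of Defs and in ℤ:
-- an identity in ℤ_n follows from the corresponding identity of integer polynomials.
infixl 6 _⊕_ _⊝_
infix  8 ⊝_

data Expr : Set where
  X Y O   : Expr
  _⊕_ _⊝_ : Expr → Expr → Expr
  ⊝_      : Expr → Expr

⟦_⟧ : Expr → ℕ → ℕ → ℕ → ℕ
⟦ X ⟧     n x y = x
⟦ Y ⟧     n x y = y
⟦ O ⟧     n x y = 0
⟦ e ⊕ f ⟧ n x y = addM n (⟦ e ⟧ n x y) (⟦ f ⟧ n x y)
⟦ e ⊝ f ⟧ n x y = subM n (⟦ e ⟧ n x y) (⟦ f ⟧ n x y)
⟦ ⊝ e ⟧   n x y = negM n (⟦ e ⟧ n x y)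

⟦_⟧ℤ : Expr → ℤ.ℤ → ℤ.ℤ → ℤ.ℤ
⟦ X ⟧ℤ     x y = x
⟦ Y ⟧ℤ     x y = y
⟦ O ⟧ℤ     x y = ℤ.0ℤ
⟦ e ⊕ f ⟧ℤ x y = ⟦ e ⟧ℤ x y ℤ.+ ⟦ f ⟧ℤ x y
⟦ e ⊝ f ⟧ℤ x y = ⟦ e ⟧ℤ x y ℤ.- ⟦ f ⟧ℤ x y
⟦ ⊝ e ⟧ℤ   x y = ℤ.- ⟦ e ⟧ℤ x y

⟦⟧-≡[mod] : ∀ n .{{_ : NonZero n}} x y e → ℤ.+ ⟦ e ⟧ n x y ≡ ⟦ e ⟧ℤ (ℤ.+ x) (ℤ.+ y) [mod n ]
⟦⟧-≡[mod] n x y X       = ≡[mod]-refl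
⟦⟧-≡[mod] n x y Y       = ≡[mod]-refl
⟦⟧-≡[mod] n x y O       = ≡[mod]-refl
⟦⟧-≡[mod] n x y (e ⊕ f) = ≡[mod]-trans (addM-≡[mod] n (⟦ e ⟧ n x y) (⟦ f ⟧ n x y))
                            (+-cong-≡[mod] (⟦⟧-≡[mod] n x y e) (⟦⟧-≡[mod] n x y f))
⟦⟧-≡[mod] n x y (e ⊝ f) = ≡[mod]-trans (subM-≡[mod] n _ _) (-‿+-cong-≡[mod] (⟦⟧-≡[mod] n x y e) (⟦⟧-≡[mod] n x y f))
⟦⟧-≡[mod] n x y (⊝ e)   = ≡[mod]-trans (negM-≡[mod] n _) (-‿cong-≡[mod] (⟦⟧-≡[mod] n x y e))

⟦⟧< : ∀ n .{{_ : NonZero n}} {x y} → x < n → y < n → ∀ e → ⟦ e ⟧ n x y < n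
⟦⟧< n         x<n y<n X       = x<n
⟦⟧< n         x<n y<n Y       = y<n
⟦⟧< n@(suc _) x<n y<n O       = z<s
⟦⟧< n         x<n y<n (e ⊕ f) = mod< n _
⟦⟧< n         x<n y<n (e ⊝ f) = mod< n _
⟦⟧< n         x<n y<n (⊝ e)   = mod< n _

⟦⟧ℤ-identity⇒⟦⟧-identity : ∀ n .{{_ : NonZero n}} {x y} → x < n → y < n → ∀ e f →
  ⟦ e ⟧ℤ (ℤ.+ x) (ℤ.+ y) ≡ ⟦ f ⟧ℤ (ℤ.+ x) (ℤ.+ y) → ⟦ e ⟧ n x y ≡ ⟦ f ⟧ n x y
⟦⟧ℤ-identity⇒⟦⟧-identity n {x} {y} x<n y<n e f e≡f = ≡[mod]⇒≡ (⟦⟧< n x<n y<n e) (⟦⟧< n x<n y<n f)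
  (≡[mod]-trans (⟦⟧-≡[mod] n x y e) (≡[mod]-trans (≡⇒≡[mod] e≡f) (≡[mod]-sym (⟦⟧-≡[mod] n x y f))))

private
  -[x-y]≡y-x : ∀ x y → ℤ.- (x ℤ.- y) ≡ y ℤ.- x
  -[x-y]≡y-x = ℤ-Solver.solve-∀

negM-subM : ∀ n .{{_ : NonZero n}} {x y} → x < n → y < n → negM n (subM n x y) ≡ subM n y x
negM-subM n {x} {y} x<n y<n = ⟦⟧ℤ-identity⇒⟦⟧-identity n x<n y<n (⊝ (X ⊝ Y)) (Y ⊝ X) (-[x-y]≡y-x (ℤ.+ x) (ℤ.+ y))

negM-involutive : ∀ n .{{_ : NonZero n}} {x} → x < n → negM n (negM n x) ≡ x
negM-involutive n {x} x<n = ⟦⟧ℤ-identity⇒⟦⟧-identity n x<n x<n (⊝ ⊝ X) X (ℤₚ.neg-involutive (ℤ.+ x))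

subM-self : ∀ n .{{_ : NonZero n}} {x} → x < n → subM n x x ≡ 0
subM-self n {x} x<n = ⟦⟧ℤ-identity⇒⟦⟧-identity n x<n x<n (X ⊝ X) O (ℤₚ.+-inverseʳ (ℤ.+ x))

addM-identityˡ : ∀ n .{{_ : NonZero n}} {x} → x < n → addM n 0 x ≡ x
addM-identityˡ n {x} x<n = ⟦⟧ℤ-identity⇒⟦⟧-identity n x<n x<n (O ⊕ X) X (ℤₚ.+-identityˡ (ℤ.+ x))

module Halving (n h : ℕ) .{{_ : NonZero n}} (h+h≡1+n : h + h ≡ suc n) where

  halve : ℕ → ℕ
  halve t = (h * t) mod n

  halve< : ∀ t → halve t < n
  halve< t = mod< n (h * t)

  private
    [h+h]*t≡t : ∀ t → ℤ.+ ((h + h) * t) ≡ ℤ.+ t [mod n ]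
    [h+h]*t≡t t = with-quotient (ℤ.+ t) (begin
      ℤ.+ ((h + h) * t)           ≡⟨ cong (λ m → ℤ.+ (m * t)) h+h≡1+n ⟩
      ℤ.+ (t + n * t)             ≡⟨ ℤₚ.pos-+ t (n * t) ⟩
      ℤ.+ t ℤ.+ ℤ.+ (n * t)       ≡⟨ cong (λ m → ℤ.+ t ℤ.+ m) (trans (ℤₚ.pos-* n t) (ℤₚ.*-comm (ℤ.+ n) (ℤ.+ t))) ⟩
      ℤ.+ t ℤ.+ ℤ.+ t ℤ.* ℤ.+ n   ∎)
      where open ≡-Reasoning

  addM-halve : ∀ {t} → t < n → addM n (halve t) (halve t) ≡ t
  addM-halve {t} t<n = ≡[mod]⇒≡ (mod< n _) t<n (begin
    ℤ.+ addM n (halve t) (halve t)    ≈⟨ addM-≡[mod] n (halve t) (halve t) ⟩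
    ℤ.+ halve t ℤ.+ ℤ.+ halve t       ≈⟨ +-cong-≡[mod] (mod-≡[mod] n (h * t)) (mod-≡[mod] n (h * t)) ⟩
    ℤ.+ (h * t) ℤ.+ ℤ.+ (h * t)       ≡⟨ ℤₚ.pos-+ (h * t) (h * t) ⟨
    ℤ.+ (h * t + h * t)               ≡⟨ cong ℤ.+_ (*-distribʳ-+ t h h) ⟨
    ℤ.+ ((h + h) * t)                 ≈⟨ [h+h]*t≡t t ⟩
    ℤ.+ t                             ∎)
    where open ≡[mod]-Reasoning n

  halve-addM : ∀ {x} → x < n → halve (addM n x x) ≡ x
  halve-addM {x} x<n = ≡[mod]⇒≡ (mod< n _) x<n (begin
    ℤ.+ halve (addM n x x)            ≈⟨ mod-≡[mod] n _ ⟩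
    ℤ.+ (h * addM n x x)              ≡⟨ ℤₚ.pos-* h _ ⟩
    ℤ.+ h ℤ.* ℤ.+ addM n x x          ≈⟨ *-congˡ-≡[mod] (ℤ.+ h) (addM-≡[mod] n x x) ⟩
    ℤ.+ h ℤ.* (ℤ.+ x ℤ.+ ℤ.+ x)       ≡⟨ trans (ℤₚ.pos-* h (x + x)) (cong (λ s → ℤ.+ h ℤ.* s) (ℤₚ.pos-+ x x)) ⟨
    ℤ.+ (h * (x + x))                 ≡⟨ cong ℤ.+_ (trans (*-distribˡ-+ h x x) (sym (*-distribʳ-+ x h h))) ⟩
    ℤ.+ ((h + h) * x)                 ≈⟨ [h+h]*t≡t x ⟩
    ℤ.+ x                             ∎)
    where open ≡[mod]-Reasoning n

  addM-double≡0⇒≡0 : ∀ {x} → x < n → addM n x x ≡ 0 → x ≡ 0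
  addM-double≡0⇒≡0 {x} x<n x+x≡0 = begin
    x                       ≡⟨ halve-addM x<n ⟨
    halve (addM n x x)      ≡⟨ cong halve (trans x+x≡0 (sym (addM-identityˡ n 0<n))) ⟩
    halve (addM n 0 0)      ≡⟨ halve-addM 0<n ⟩
    0                       ∎
    where
    open ≡-Reasoning
    0<n : 0 < n
    0<n = ≤-<-trans z≤n x<n

-- Base-k digits in ℤ_{kv}

toDigits : ∀ k {v} .{{_ : NonZero k}} z → z < k * v → ∃₂ λ r q → r < k × q < v × z ≡ r + k * q
toDigits k {v} z z<kv =
  z % k , z / k , m%n<n z k , m<n*o⇒m/o<n (subst (z <_) (*-comm k v) z<kv) ,
  trans (m≡m%n+[m/n]*n z k) (cong (λ t → z % k + t) (*-comm (z / k) k))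

digits-injective : ∀ {k r₁ r₂ a b} .{{_ : NonZero k}} → r₁ < k → r₂ < k →
  r₁ + k * a ≡ r₂ + k * b → r₁ ≡ r₂ × a ≡ b
digits-injective {k} {r₁} {r₂} {a} {b} r₁<k r₂<k eq =
  r₁≡r₂ , *-cancelˡ-≡ a b k (+-cancelˡ-≡ r₁ _ _ (trans eq (cong (λ t → t + k * b) (sym r₁≡r₂))))
  where
  lowDigit : ∀ {r} c → r < k → (r + k * c) % k ≡ r
  lowDigit {r} c r<k = trans (cong (λ t → (r + t) % k) (*-comm k c)) (trans ([m+kn]%n≡m%n r c k) (m<n⇒m%n≡m r<k))
  r₁≡r₂ : r₁ ≡ r₂
  r₁≡r₂ = trans (sym (lowDigit a r₁<k)) (trans (cong (_% k) eq) (lowDigit b r₂<k))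

digits< : ∀ {k v r a} → r < k → a < v → r + k * a < k * v
digits< {k} {v} {r} {a} r<k a<v = begin-strict
  r + k * a   <⟨ +-monoˡ-< (k * a) r<k ⟩
  k + k * a   ≡⟨ *-suc k a ⟨
  k * suc a   ≤⟨ *-monoʳ-≤ k a<v ⟩
  k * v       ∎
  where open ≤-Reasoning

private
  pos-digits : ∀ r k a → ℤ.+ (r + k * a) ≡ ℤ.+ r ℤ.+ ℤ.+ k ℤ.* ℤ.+ a
  pos-digits r k a = trans (ℤₚ.pos-+ r (k * a)) (cong (λ t → ℤ.+ r ℤ.+ t) (ℤₚ.pos-* k a))

  digits-difference : ∀ r₁ r₂ k a b →
    (r₁ ℤ.+ k ℤ.* a) ℤ.- (r₂ ℤ.+ k ℤ.* b) ≡ (r₁ ℤ.- r₂) ℤ.+ k ℤ.* (a ℤ.- b)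
  digits-difference = ℤ-Solver.solve-∀

  digits-negation : ∀ r k q v →
    (k ℤ.- r) ℤ.+ k ℤ.* (v ℤ.- (ℤ.1ℤ ℤ.+ q)) ≡ ℤ.- (r ℤ.+ k ℤ.* q) ℤ.+ ℤ.1ℤ ℤ.* (k ℤ.* v)
  digits-negation = ℤ-Solver.solve-∀

subM-digits : ∀ {k v r₁ r₂ a b} .{{_ : NonZero k}} .{{_ : NonZero v}} → r₂ ≤ r₁ → r₁ < k → a < v → b < v →
  subM (k * v) (r₁ + k * a) (r₂ + k * b) ≡ (r₁ ∸ r₂) + k * subM v a b
subM-digits {k} {v} {r₁} {r₂} {a} {b} r₂≤r₁ r₁<k a<v b<v =
  ≡[mod]⇒≡ (mod< (k * v) _) (digits< (≤-<-trans (m∸n≤m r₁ r₂) r₁<k) (mod< v _)) (begin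
    ℤ.+ subM (k * v) (r₁ + k * a) (r₂ + k * b)
      ≈⟨ subM-≡[mod] (k * v) _ _ ⟩
    ℤ.+ (r₁ + k * a) ℤ.- ℤ.+ (r₂ + k * b)
      ≡⟨ cong₂ ℤ._-_ (pos-digits r₁ k a) (pos-digits r₂ k b) ⟩
    (ℤ.+ r₁ ℤ.+ ℤ.+ k ℤ.* ℤ.+ a) ℤ.- (ℤ.+ r₂ ℤ.+ ℤ.+ k ℤ.* ℤ.+ b)
      ≡⟨ digits-difference (ℤ.+ r₁) (ℤ.+ r₂) (ℤ.+ k) (ℤ.+ a) (ℤ.+ b) ⟩
    (ℤ.+ r₁ ℤ.- ℤ.+ r₂) ℤ.+ ℤ.+ k ℤ.* (ℤ.+ a ℤ.- ℤ.+ b)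
      ≈⟨ +-congˡ-≡[mod] (ℤ.+ r₁ ℤ.- ℤ.+ r₂) (*-scale-≡[mod] k (subM-≡[mod] v a b)) ⟨
    (ℤ.+ r₁ ℤ.- ℤ.+ r₂) ℤ.+ ℤ.+ k ℤ.* ℤ.+ subM v a b
      ≡⟨ trans (pos-digits (r₁ ∸ r₂) k _) (cong (λ t → t ℤ.+ ℤ.+ k ℤ.* ℤ.+ subM v a b) (pos-∸ r₂≤r₁)) ⟨
    ℤ.+ ((r₁ ∸ r₂) + k * subM v a b)
      ∎)
  where
  instance _ = m*n≢0 k v
  open ≡[mod]-Reasoning (k * v)

negM-digits : ∀ {k v r q} .{{_ : NonZero k}} .{{_ : NonZero v}} → 0 < r → r < k → q < v →
  negM (k * v) (r + k * q) ≡ (k ∸ r) + k * (v ∸ suc q)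
negM-digits {k} {v} {r} {q} 0<r r<k q<v =
  ≡[mod]⇒≡ (mod< (k * v) _) (digits< (∸-monoʳ-< 0<r (<⇒≤ r<k)) (∸-monoʳ-< z<s q<v)) (begin
    ℤ.+ negM (k * v) (r + k * q)                             ≈⟨ negM-≡[mod] (k * v) _ ⟩
    ℤ.- ℤ.+ (r + k * q)                                      ≡⟨ cong ℤ.-_ (pos-digits r k q) ⟩
    ℤ.- (ℤ.+ r ℤ.+ ℤ.+ k ℤ.* ℤ.+ q)                          ≈⟨ wrap ⟨
    (ℤ.+ k ℤ.- ℤ.+ r) ℤ.+ ℤ.+ k ℤ.* (ℤ.+ v ℤ.- (ℤ.1ℤ ℤ.+ ℤ.+ q))  ≡⟨ unfold ⟨
    ℤ.+ ((k ∸ r) + k * (v ∸ suc q))                          ∎)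
  where
  instance _ = m*n≢0 k v
  open ≡[mod]-Reasoning (k * v)
  wrap : (ℤ.+ k ℤ.- ℤ.+ r) ℤ.+ ℤ.+ k ℤ.* (ℤ.+ v ℤ.- (ℤ.1ℤ ℤ.+ ℤ.+ q)) ≡ ℤ.- (ℤ.+ r ℤ.+ ℤ.+ k ℤ.* ℤ.+ q) [mod k * v ]
  wrap = with-quotient ℤ.1ℤ (trans (digits-negation (ℤ.+ r) (ℤ.+ k) (ℤ.+ q) (ℤ.+ v))
    (cong (λ t → ℤ.- (ℤ.+ r ℤ.+ ℤ.+ k ℤ.* ℤ.+ q) ℤ.+ ℤ.1ℤ ℤ.* t) (sym (ℤₚ.pos-* k v))))
  unfold : ℤ.+ ((k ∸ r) + k * (v ∸ suc q)) ≡ (ℤ.+ k ℤ.- ℤ.+ r) ℤ.+ ℤ.+ k ℤ.* (ℤ.+ v ℤ.- (ℤ.1ℤ ℤ.+ ℤ.+ q))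
  unfold = trans (pos-digits (k ∸ r) k (v ∸ suc q)) (cong₂ (λ s t → s ℤ.+ ℤ.+ k ℤ.* t) (pos-∸ (<⇒≤ r<k))
    (trans (pos-∸ q<v) (cong (λ t → ℤ.+ v ℤ.- t) (ℤₚ.pos-+ 1 q))))

private
  differenceFrom : ℕ → ℕ → ℕ → List ℕ
  differenceFrom n x y = if x ≡ᵇ y then [] else subM n x y ∷ []

  ∈-differenceFrom⁺ : ∀ n {x y} → x ≢ y → subM n x y ∈ differenceFrom n x y
  ∈-differenceFrom⁺ n {x} {y} x≢y with x ≡ᵇ y in eq
  ... | true  = ⊥-elim (x≢y (≡ᵇ⇒≡ x y (subst T (sym eq) tt)))
  ... | false = here refl

  ∈-differenceFrom⁻ : ∀ n {x y w} → w ∈ differenceFrom n x y → x ≢ y × w ≡ subM n x y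
  ∈-differenceFrom⁻ n {x} {y} w∈ with x ≡ᵇ y in eq | w∈
  ... | false | here w≡ = (λ x≡y → subst T eq (≡⇒≡ᵇ x y x≡y)) , w≡

  length-differenceFrom : ∀ n x y → length (differenceFrom n x y) ≤ 1
  length-differenceFrom n x y with x ≡ᵇ y
  ... | true  = z≤n
  ... | false = s≤s z≤n

  differenceFrom-self : ∀ n x → differenceFrom n x x ≡ []
  differenceFrom-self n x with x ≡ᵇ x in eq
  ... | true  = refl
  ... | false = ⊥-elim (subst T eq (≡⇒≡ᵇ x x refl))

  differencesFrom : ℕ → List ℕ → ℕ → List ℕ
  differencesFrom n C x = concatMap (differenceFrom n x) C

  length-differencesFrom≤ : ∀ n x C → length (differencesFrom n C x) ≤ length C
  length-differencesFrom≤ n x []      = z≤n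
  length-differencesFrom≤ n x (y ∷ C) = ≤-trans (≤-reflexive (length-++ (differenceFrom n x y)))
    (+-mono-≤ (length-differenceFrom n x y) (length-differencesFrom≤ n x C))

  length-differencesFrom< : ∀ n {x C} → x ∈ C → suc (length (differencesFrom n C x)) ≤ length C
  length-differencesFrom< n {x} {x ∷ C} (here refl) rewrite differenceFrom-self n x =
    s≤s (length-differencesFrom≤ n x C)
  length-differencesFrom< n {x} {y ∷ C} (there x∈C) = s≤s (≤-trans (≤-reflexive (length-++ (differenceFrom n x y)))
    (≤-trans (+-monoˡ-≤ _ (length-differenceFrom n x y)) (length-differencesFrom< n x∈C)))

∈-diffs⁺ : ∀ n {C x y} → x ∈ C → y ∈ C → x ≢ y → subM n x y ∈ diffs n C
∈-diffs⁺ n x∈C y∈C x≢y = ∈-concatMap⁺ _ (lose x∈C (∈-concatMap⁺ _ (lose y∈C (∈-differenceFrom⁺ n x≢y))))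

∈-diffs⁻ : ∀ n {C w} → w ∈ diffs n C → ∃₂ λ x y → x ∈ C × y ∈ C × x ≢ y × w ≡ subM n x y
∈-diffs⁻ n {C} w∈ with x , x∈C , w∈x ← find (∈-concatMap⁻ (differencesFrom n C) w∈)
  with y , y∈C , w∈xy ← find (∈-concatMap⁻ (differenceFrom n x) w∈x)
  with x≢y , w≡ ← ∈-differenceFrom⁻ n w∈xy = x , y , x∈C , y∈C , x≢y , w≡

∈-Δ⁺ : ∀ n {B C w} → C ∈ B → w ∈ diffs n C → w ∈ Δ n B
∈-Δ⁺ n C∈B w∈ = ∈-concatMap⁺ (diffs n) (lose C∈B w∈)

∈-Δ⁻ : ∀ n {B w} → w ∈ Δ n B → ∃ λ C → C ∈ B × w ∈ diffs n C
∈-Δ⁻ n w∈ = find (∈-concatMap⁻ (diffs n) w∈)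

length-diffs : ∀ n C → length (diffs n C) ≤ length C * (length C ∸ 1)
length-diffs n C = go C (λ x∈ → x∈)
  where
  go : ∀ D → D ⊆ C → length (concatMap (differencesFrom n C) D) ≤ length D * (length C ∸ 1)
  go []      _    = z≤n
  go (x ∷ D) D⊆C = ≤-trans (≤-reflexive (length-++ (differencesFrom n C x)))
    (+-mono-≤ (∸-monoˡ-≤ 1 (length-differencesFrom< n (D⊆C (here refl)))) (go D (λ x∈ → D⊆C (there x∈))))

length-Δ : ∀ n k B → All (λ C → length C ≡ k) B → length (Δ n B) ≤ length B * (k * (k ∸ 1))
length-Δ n k []      []              = z≤n
length-Δ n k (C ∷ B) (refl ∷ |B|≡k) =
  ≤-trans (≤-reflexive (length-++ (diffs n C))) (+-mono-≤ (length-diffs n C) (length-Δ n k B |B|≡k))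

negM-∈-Δ : ∀ n .{{_ : NonZero n}} {B w} → All (All (_< n)) B → w ∈ Δ n B → negM n w ∈ Δ n B
negM-∈-Δ n {B} B<n w∈Δ with C , C∈B , w∈C ← ∈-Δ⁻ n w∈Δ
  with x , y , x∈C , y∈C , x≢y , refl ← ∈-diffs⁻ n w∈C =
  subst (_∈ Δ n B) (sym (negM-subM n (All.lookup C<n x∈C) (All.lookup C<n y∈C)))
    (∈-Δ⁺ n C∈B (∈-diffs⁺ n y∈C x∈C (≢-sym x≢y)))
  where
  C<n : All (_< n) C
  C<n = All.lookup B<n C∈B

-- Codes from pair systems

-- PS(v) is the case δ = 0 with no exceptions, APS(v, α, β) the case δ = 1 with EA = ±α and EB = ±β.
record PairSystem (v : ℕ) (S : List (ℕ × ℕ)) (EA EB : List ℕ) : Set where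
  field
    δ             : ℕ
    δ≤1           : δ ≤ 1
    v≡1+2[2|S|+δ] : v ≡ 1 + 2 * (2 * length S + δ)
    length-EA     : length EA ≡ 2 * δ
    length-EB     : length EB ≡ 2 * δ
    pairs-sound   : ∀ q → q ∈ unionPair v S → q < v × q ≢ 0
    sums-sound    : ∀ q → q ∈ unionDiffSum v S → q < v × q ≢ 0
    pairs-cover   : ∀ q → q < v → q ≢ 0 → q ∉ EA → q ∈ unionPair v S
    sums-cover    : ∀ q → q < v → q ≢ 0 → q ∉ EB → q ∈ unionDiffSum v S

∈-concatMap-All : ∀ {A B : Set} {P : B → Set} (f : A → List B) {xs} →
  (∀ {x} → x ∈ xs → All P (f x)) → ∀ {y} → y ∈ concatMap f xs → P y
∈-concatMap-All f all y∈ with x , x∈xs , y∈fx ← find (∈-concatMap⁻ f y∈) = All.lookup (all x∈xs) y∈fx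

module SymmetricCover (h v : ℕ) .{{_ : NonZero v}} where

  k : ℕ
  k = suc (h + h)

  private instance _ = m*n≢0 k v

  -- Residues whose lowest base-k digit exceeds h are negatives of residues whose lowest digit is at most h.
  cover : (D : ℕ → Set) (M₀ M₊ : List ℕ) →
    (∀ {w} → w < k * v → D w → D (negM (k * v) w)) →
    (∀ q → q < v → k * q ∉ M₀ → D (k * q)) →
    (∀ r q → 0 < r → r ≤ h → q < v → r + k * q ∉ M₊ → D (r + k * q)) →
    ∀ z → z < k * v → z ∉ M₀ ++ M₊ ++ map (negM (k * v)) M₊ → D z
  cover D M₀ M₊ D-negM D₀ D₊ z z<kv z∉M with toDigits k z z<kv
  ... | zero , q , _ , q<v , refl = D₀ q q<v (λ z∈ → z∉M (∈-++⁺ˡ z∈))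
  ... | r@(suc _) , q , r<k , q<v , refl with r ≤? h
  ...   | yes r≤h = D₊ r q (s≤s z≤n) r≤h q<v (λ z∈ → z∉M (∈-++⁺ʳ M₀ (∈-++⁺ˡ z∈)))
  ...   | no  r≰h = subst D (trans (cong (negM (k * v)) (sym -z≡w)) (negM-involutive (k * v) z<kv))
                      (D-negM (digits< k∸r<k q′<v) (D₊ (k ∸ r) q′ (m<n⇒0<n∸m r<k) k∸r≤h q′<v w∉M₊))
    where
    q′ : ℕ
    q′ = v ∸ suc q
    -z≡w : negM (k * v) (r + k * q) ≡ (k ∸ r) + k * q′
    -z≡w = negM-digits (s≤s z≤n) r<k q<v
    k∸r≤h : k ∸ r ≤ h
    k∸r≤h = ≤-trans (∸-monoʳ-≤ k (≰⇒> r≰h)) (≤-reflexive (m+n∸m≡n h h))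
    k∸r<k : k ∸ r < k
    k∸r<k = ∸-monoʳ-< (s≤s z≤n) (<⇒≤ r<k)
    q′<v : q′ < v
    q′<v = ∸-monoʳ-< (s≤s z≤n) q<v
    w∉M₊ : (k ∸ r) + k * q′ ∉ M₊
    w∉M₊ w∈ = z∉M (∈-++⁺ʳ M₀ (∈-++⁺ʳ M₊ (subst (_∈ map (negM (k * v)) M₊)
      (trans (cong (negM (k * v)) (sym -z≡w)) (negM-involutive (k * v) z<kv)) (∈-map⁺ (negM (k * v)) w∈))))

module PairSystemProperties {v S EA EB} (P : PairSystem v S EA EB) where
  open PairSystem P

  instance
    nonZero-v : NonZero v
    nonZero-v = subst NonZero (sym v≡1+2[2|S|+δ]) _

  private
    ∈-unionPair : ∀ {p q} → p ∈ S → q ∈ pmPair v p → q ∈ unionPair v S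
    ∈-unionPair p∈S q∈ = ∈-concatMap⁺ (pmPair v) (lose p∈S q∈)

    ∈-unionDiffSum : ∀ {p q} → p ∈ S → q ∈ pmDiffSum v p → q ∈ unionDiffSum v S
    ∈-unionDiffSum p∈S q∈ = ∈-concatMap⁺ (pmDiffSum v) (lose p∈S q∈)

  module _ {x y} (xy∈S : (x , y) ∈ S) where
    x<v : x < v
    x<v = proj₁ (pairs-sound x (∈-unionPair xy∈S (here refl)))
    x≢0 : x ≢ 0
    x≢0 = proj₂ (pairs-sound x (∈-unionPair xy∈S (here refl)))
    y<v : y < v
    y<v = proj₁ (pairs-sound y (∈-unionPair xy∈S (there (there (here refl)))))
    y≢0 : y ≢ 0
    y≢0 = proj₂ (pairs-sound y (∈-unionPair xy∈S (there (there (here refl)))))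
    x-y≢0 : subM v x y ≢ 0
    x-y≢0 = proj₂ (sums-sound _ (∈-unionDiffSum xy∈S (here refl)))
    x≢y : x ≢ y
    x≢y refl = x-y≢0 (subM-self v x<v)
    x+y≢0 : addM v x y ≢ 0
    x+y≢0 = proj₂ (sums-sound _ (∈-unionDiffSum xy∈S (there (there (here refl)))))

  covered-by-pairs : ∀ (Q : ℕ → Set) → (∀ {p} → p ∈ S → All Q (pmPair v p)) →
    ∀ q → q < v → q ≢ 0 → q ∉ EA → Q q
  covered-by-pairs Q all q q<v q≢0 q∉EA = ∈-concatMap-All (pmPair v) all (pairs-cover q q<v q≢0 q∉EA)

  covered-by-sums : ∀ (Q : ℕ → Set) → (∀ {p} → p ∈ S → All Q (pmDiffSum v p)) →
    ∀ q → q < v → q ≢ 0 → q ∉ EB → Q q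
  covered-by-sums Q all q q<v q≢0 q∉EB = ∈-concatMap-All (pmDiffSum v) all (sums-cover q q<v q≢0 q∉EB)

forbidden : ℕ → ℕ → List ℕ → List ℕ
forbidden k r E = map (λ a → r + k * a) (0 ∷ E)

∉-forbidden : ∀ k r {q E} → r + k * q ∉ forbidden k r E → q ≢ 0 × q ∉ E
∉-forbidden k r z∉ = (λ { refl → z∉ (here refl) }) , (λ q∈E → z∉ (there (∈-map⁺ (λ a → r + k * a) q∈E)))

length-forbidden : ∀ k r E → length (forbidden k r E) ≡ suc (length E)
length-forbidden k r E = length-map (λ a → r + k * a) (0 ∷ E)

length-++-++-map : ∀ (xs ys : List ℕ) f → length (xs ++ ys ++ map f ys) ≡ length xs + 2 * length ys
length-++-++-map xs ys f = begin
  length (xs ++ ys ++ map f ys)                  ≡⟨ length-++ xs ⟩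
  length xs + length (ys ++ map f ys)            ≡⟨ cong (λ t → length xs + t) (length-++ ys) ⟩
  length xs + (length ys + length (map f ys))    ≡⟨ cong (λ t → length xs + (length ys + t)) (length-map f ys) ⟩
  length xs + (length ys + length ys)            ≡⟨ cong (λ t → length xs + (length ys + t)) (+-identityʳ _) ⟨
  length xs + 2 * length ys                      ∎
  where open ≡-Reasoning

module DigitCode (k v : ℕ) .{{_ : NonZero k}} .{{_ : NonZero v}} (shape : List (ℕ × Expr)) (S : List (ℕ × ℕ)) where

  private instance _ = m*n≢0 k v

  entry : ℕ → ℕ → ℕ × Expr → ℕ
  entry x y s = proj₁ s + k * ⟦ proj₂ s ⟧ v x y

  codeword : ℕ × ℕ → List ℕ
  codeword (x , y) = map (entry x y) shape

  code : List (List ℕ)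
  code = map codeword S

  module AtPair {x y} (xy∈S : (x , y) ∈ S) (x<v : x < v) (y<v : y < v) where

    data Distinct (s t : ℕ × Expr) : Set where
      digits-differ : proj₁ s ≢ proj₁ t → Distinct s t
      values-differ : ⟦ proj₂ s ⟧ v x y ≢ ⟦ proj₂ t ⟧ v x y → Distinct s t

    Distinct-sym : ∀ {s t} → Distinct s t → Distinct t s
    Distinct-sym (digits-differ r≢r′) = digits-differ (≢-sym r≢r′)
    Distinct-sym (values-differ e≢e′) = values-differ (≢-sym e≢e′)

    Distinct⇒entry≢ : ∀ {s t} → proj₁ s < k → proj₁ t < k → Distinct s t → entry x y s ≢ entry x y t
    Distinct⇒entry≢ r<k r′<k (digits-differ r≢r′) eq = r≢r′ (proj₁ (digits-injective r<k r′<k eq))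
    Distinct⇒entry≢ r<k r′<k (values-differ e≢e′) eq = e≢e′ (proj₂ (digits-injective r<k r′<k eq))

    codeword< : ∀ {sh} → All (λ s → proj₁ s < k) sh → All (_< k * v) (map (entry x y) sh)
    codeword< digits<k = map⁺ (All.map (λ {(r , e)} r<k → digits< r<k (⟦⟧< v x<v y<v e)) digits<k)

    codeword-Unique : ∀ {sh} → All (λ s → proj₁ s < k) sh → AllPairs Distinct sh → Unique (map (entry x y) sh)
    codeword-Unique []           []       = []
    codeword-Unique (r<k ∷ rs<k) (d ∷ ds) =
      map⁺ (All.zipWith (λ (r′<k , d′) → Distinct⇒entry≢ r<k r′<k d′) (rs<k , d)) ∷ codeword-Unique rs<k ds

    difference∈Δ : ∀ {r₁ r₂ e₁ e₂} → (r₁ , e₁) ∈ shape → (r₂ , e₂) ∈ shape →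
      Distinct (r₁ , e₁) (r₂ , e₂) → r₂ ≤ r₁ → r₁ < k → ∀ e →
      ⟦ e ⟧ℤ (ℤ.+ x) (ℤ.+ y) ≡ ⟦ e₁ ⟧ℤ (ℤ.+ x) (ℤ.+ y) ℤ.- ⟦ e₂ ⟧ℤ (ℤ.+ x) (ℤ.+ y) →
      (r₁ ∸ r₂) + k * ⟦ e ⟧ v x y ∈ Δ (k * v) code
    difference∈Δ {r₁} {r₂} {e₁} {e₂} i₁ i₂ distinct r₂≤r₁ r₁<k e e≡e₁-e₂ =
      subst (_∈ Δ (k * v) code)
        (trans (subM-digits r₂≤r₁ r₁<k (⟦⟧< v x<v y<v e₁) (⟦⟧< v x<v y<v e₂))
               (cong (λ t → (r₁ ∸ r₂) + k * t) (⟦⟧ℤ-identity⇒⟦⟧-identity v x<v y<v (e₁ ⊝ e₂) e (sym e≡e₁-e₂))))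
        (∈-Δ⁺ (k * v) (∈-map⁺ codeword xy∈S) (∈-diffs⁺ (k * v) (∈-map⁺ (entry x y) i₁) (∈-map⁺ (entry x y) i₂)
          (Distinct⇒entry≢ r₁<k (≤-<-trans r₂≤r₁ r₁<k) distinct)))

private
  -x≡y-[x+y] : ∀ x y → ℤ.- x ≡ y ℤ.- (x ℤ.+ y)
  -x≡y-[x+y] = ℤ-Solver.solve-∀
  -y≡x-[x+y] : ∀ x y → ℤ.- y ≡ x ℤ.- (x ℤ.+ y)
  -y≡x-[x+y] = ℤ-Solver.solve-∀

module OOC-3v {v S EA EB} (P : PairSystem v S EA EB) where

  open PairSystem P
  open PairSystemProperties P
  private instance _ = m*n≢0 3 v

  -- (r , e) stands for r + 3e: the codeword {0, 3(x+y), 1+3x, 1+3y}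
  shape : List (ℕ × Expr)
  shape = (0 , O) ∷ (0 , X ⊕ Y) ∷ (1 , X) ∷ (1 , Y) ∷ []

  open DigitCode 3 v shape S public

  module _ {x y} (xy∈S : (x , y) ∈ S) where
    open AtPair xy∈S (x<v xy∈S) (y<v xy∈S)

    private
      s₀ : (0 , O) ∈ shape
      s₀ = here refl
      s₁ : (0 , X ⊕ Y) ∈ shape
      s₁ = there (here refl)
      s₂ : (1 , X) ∈ shape
      s₂ = there (there (here refl))
      s₃ : (1 , Y) ∈ shape
      s₃ = there (there (there (here refl)))
      0<3 : 0 < 3
      0<3 = s≤s z≤n
      1<3 : 1 < 3
      1<3 = s≤s (s≤s z≤n)
      digits<3 : All (λ s → proj₁ s < 3) shape
      digits<3 = 0<3 ∷ 0<3 ∷ 1<3 ∷ 1<3 ∷ []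
      0≢3[x+y] : Distinct (0 , O) (0 , X ⊕ Y)
      0≢3[x+y] = values-differ (≢-sym (x+y≢0 xy∈S))
      1+3x≢1+3y : Distinct (1 , X) (1 , Y)
      1+3x≢1+3y = values-differ (x≢y xy∈S)

    codeword-valid : (length (codeword (x , y)) ≡ 4) × Unique (codeword (x , y)) × All (_< 3 * v) (codeword (x , y))
    codeword-valid = refl , codeword-Unique digits<3 distinct , codeword< digits<3
      where
      distinct : AllPairs Distinct shape
      distinct =
        (0≢3[x+y] ∷ digits-differ (λ ()) ∷ digits-differ (λ ()) ∷ []) ∷
        (digits-differ (λ ()) ∷ digits-differ (λ ()) ∷ []) ∷
        (1+3x≢1+3y ∷ []) ∷ [] ∷ []

    multiples-of-3 : All (λ q → 3 * q ∈ Δ (3 * v) code) (pmDiffSum v (x , y))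
    multiples-of-3 =
      difference∈Δ s₂ s₃ 1+3x≢1+3y ≤-refl 1<3 (X ⊝ Y) refl ∷
      difference∈Δ s₃ s₂ (Distinct-sym 1+3x≢1+3y) ≤-refl 1<3 (⊝ (X ⊝ Y)) (-[x-y]≡y-x (ℤ.+ x) (ℤ.+ y)) ∷
      difference∈Δ s₁ s₀ (Distinct-sym 0≢3[x+y]) z≤n 0<3 (X ⊕ Y) (sym (ℤₚ.+-identityʳ _)) ∷
      difference∈Δ s₀ s₁ 0≢3[x+y] z≤n 0<3 (⊝ (X ⊕ Y)) (sym (ℤₚ.+-identityˡ _)) ∷ []

    one-plus-multiples-of-3 : All (λ q → 1 + 3 * q ∈ Δ (3 * v) code) (pmPair v (x , y))
    one-plus-multiples-of-3 =
      difference∈Δ s₂ s₀ (digits-differ (λ ())) z≤n 1<3 X (sym (ℤₚ.+-identityʳ _)) ∷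
      difference∈Δ s₃ s₁ (digits-differ (λ ())) z≤n 1<3 (⊝ X) (-x≡y-[x+y] (ℤ.+ x) (ℤ.+ y)) ∷
      difference∈Δ s₃ s₀ (digits-differ (λ ())) z≤n 1<3 Y (sym (ℤₚ.+-identityʳ _)) ∷
      difference∈Δ s₂ s₁ (digits-differ (λ ())) z≤n 1<3 (⊝ Y) (-y≡x-[x+y] (ℤ.+ x) (ℤ.+ y)) ∷ []

  private
    M₀ M₊ M : List ℕ
    M₀ = forbidden 3 0 EB
    M₊ = forbidden 3 1 EA
    M  = M₀ ++ M₊ ++ map (negM (3 * v)) M₊

    code< : All (All (_< 3 * v)) code
    code< = map⁺ (All.tabulate (λ xy∈S → proj₂ (proj₂ (codeword-valid xy∈S))))

    covers : ∀ z → z < 3 * v → z ∉ M → z ∈ Δ (3 * v) code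
    covers = SymmetricCover.cover 1 v (_∈ Δ (3 * v) code) M₀ M₊ (λ _ → negM-∈-Δ (3 * v) code<) D₀ D₊
      where
      D₀ : ∀ q → q < v → 3 * q ∉ M₀ → 3 * q ∈ Δ (3 * v) code
      D₀ q q<v 3q∉M₀ with q≢0 , q∉EB ← ∉-forbidden 3 0 3q∉M₀ =
        covered-by-sums (λ q → 3 * q ∈ Δ (3 * v) code) multiples-of-3 q q<v q≢0 q∉EB
      D₊ : ∀ r q → 0 < r → r ≤ 1 → q < v → r + 3 * q ∉ M₊ → r + 3 * q ∈ Δ (3 * v) code
      D₊ 1 q _ _ q<v z∉M₊ with q≢0 , q∉EA ← ∉-forbidden 3 1 z∉M₊ =
        covered-by-pairs (λ q → 1 + 3 * q ∈ Δ (3 * v) code) one-plus-multiples-of-3 q q<v q≢0 q∉EA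
      D₊ (suc (suc _)) _ _ (s≤s ()) _ _

    length-M : length M ≡ 3 * (1 + 2 * δ)
    length-M = begin
      length M                                ≡⟨ length-++-++-map M₀ M₊ (negM (3 * v)) ⟩
      length M₀ + 2 * length M₊
        ≡⟨ cong₂ (λ a b → a + 2 * b) (length-forbidden 3 0 EB) (length-forbidden 3 1 EA) ⟩
      suc (length EB) + 2 * suc (length EA)   ≡⟨ cong₂ (λ a b → suc a + 2 * suc b) length-EB length-EA ⟩
      3 * (1 + 2 * δ)                         ∎
      where open ≡-Reasoning

    |C|≡4 : All (λ C → length C ≡ 4) code
    |C|≡4 = map⁺ (All.tabulate (λ xy∈S → proj₁ (codeword-valid xy∈S)))

    |Δ|+|M|≤3v : length (Δ (3 * v) code) + length M ≤ 3 * v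
    |Δ|+|M|≤3v = begin
      length (Δ (3 * v) code) + length M   ≤⟨ +-monoˡ-≤ (length M) (length-Δ (3 * v) 4 code |C|≡4) ⟩
      length code * 12 + length M          ≡⟨ cong₂ (λ s m → s * 12 + m) (length-map codeword S) length-M ⟩
      length S * 12 + 3 * (1 + 2 * δ)      ≡⟨ count (length S) δ ⟩
      3 * (1 + 2 * (2 * length S + δ))     ≡⟨ cong (3 *_) v≡1+2[2|S|+δ] ⟨
      3 * v                                ∎
      where
      open ≤-Reasoning
      count : ∀ s d → s * 12 + 3 * (1 + 2 * d) ≡ 3 * (1 + 2 * (2 * s + d))
      count = solve-∀

  isMaxOOC : IsMaxOOC (3 * v) 4 code
  isMaxOOC = covering⇒IsMaxOOC (3 * v) 4 code M (map⁺ (All.tabulate codeword-valid)) covers |Δ|+|M|≤3v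
    (≤-trans (≤-reflexive length-M) (≤-trans (*-monoʳ-≤ 3 (+-monoʳ-≤ 1 (*-monoʳ-≤ 2 δ≤1))) (m≤m+n 9 3)))

private
  -x+-x≡0-[x+x] : ∀ x → ℤ.- x ℤ.+ ℤ.- x ≡ ℤ.0ℤ ℤ.- (x ℤ.+ x)
  -x+-x≡0-[x+x] = ℤ-Solver.solve-∀
  y+y≡[x+y]-[x-y] : ∀ x y → y ℤ.+ y ≡ (x ℤ.+ y) ℤ.- (x ℤ.- y)
  y+y≡[x+y]-[x-y] = ℤ-Solver.solve-∀
  -y+-y≡[x-y]-[x+y] : ∀ x y → ℤ.- y ℤ.+ ℤ.- y ≡ (x ℤ.- y) ℤ.- (x ℤ.+ y)
  -y+-y≡[x-y]-[x+y] = ℤ-Solver.solve-∀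
  -x≡x-[x+x] : ∀ x → ℤ.- x ≡ x ℤ.- (x ℤ.+ x)
  -x≡x-[x+x] = ℤ-Solver.solve-∀
  y≡[x+y]-x : ∀ x y → y ≡ (x ℤ.+ y) ℤ.- x
  y≡[x+y]-x = ℤ-Solver.solve-∀
  -y≡[x-y]-x : ∀ x y → ℤ.- y ≡ (x ℤ.- y) ℤ.- x
  -y≡[x-y]-x = ℤ-Solver.solve-∀
  -[x-y]≡[x+y]-[x+x] : ∀ x y → ℤ.- (x ℤ.- y) ≡ (x ℤ.+ y) ℤ.- (x ℤ.+ x)
  -[x-y]≡[x+y]-[x+x] = ℤ-Solver.solve-∀
  -[x+y]≡[x-y]-[x+x] : ∀ x y → ℤ.- (x ℤ.+ y) ≡ (x ℤ.- y) ℤ.- (x ℤ.+ x)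
  -[x+y]≡[x-y]-[x+x] = ℤ-Solver.solve-∀

module OOC-5v {v S EA EB} (P : PairSystem v S EA EB) where

  open PairSystem P
  open PairSystemProperties P
  private instance _ = m*n≢0 5 v

  -- (r , e) stands for r + 5e: the codeword {0, 5(2x), 1+5x, 2+5(x+y), 2+5(x-y)}
  shape : List (ℕ × Expr)
  shape = (0 , O) ∷ (0 , X ⊕ X) ∷ (1 , X) ∷ (2 , X ⊕ Y) ∷ (2 , X ⊝ Y) ∷ []

  open DigitCode 5 v shape S public

  private
    2h≡1+v : suc (2 * length S + δ) + suc (2 * length S + δ) ≡ suc v
    2h≡1+v = trans (double (2 * length S + δ)) (cong suc (sym v≡1+2[2|S|+δ]))
      where
      double : ∀ s → suc s + suc s ≡ suc (1 + 2 * s)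
      double = solve-∀

  open Halving v (suc (2 * length S + δ)) 2h≡1+v

  module _ {x y} (xy∈S : (x , y) ∈ S) where
    open AtPair xy∈S (x<v xy∈S) (y<v xy∈S)

    private
      s₀ : (0 , O) ∈ shape
      s₀ = here refl
      s₁ : (0 , X ⊕ X) ∈ shape
      s₁ = there (here refl)
      s₂ : (1 , X) ∈ shape
      s₂ = there (there (here refl))
      s₃ : (2 , X ⊕ Y) ∈ shape
      s₃ = there (there (there (here refl)))
      s₄ : (2 , X ⊝ Y) ∈ shape
      s₄ = there (there (there (there (here refl))))
      0<5 : 0 < 5
      0<5 = s≤s z≤n
      1<5 : 1 < 5
      1<5 = s≤s (s≤s z≤n)
      2<5 : 2 < 5
      2<5 = s≤s (s≤s (s≤s z≤n))
      digits<5 : All (λ s → proj₁ s < 5) shape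
      digits<5 = 0<5 ∷ 0<5 ∷ 1<5 ∷ 2<5 ∷ 2<5 ∷ []

      x+x≢0 : addM v x x ≢ 0
      x+x≢0 eq = x≢0 xy∈S (addM-double≡0⇒≡0 (x<v xy∈S) eq)

      x+y≢x-y : addM v x y ≢ subM v x y
      x+y≢x-y eq = y≢0 xy∈S (addM-double≡0⇒≡0 (y<v xy∈S) (begin
        addM v y y                              ≡⟨ ⟦⟧ℤ-identity⇒⟦⟧-identity v (x<v xy∈S) (y<v xy∈S) (Y ⊕ Y) (X ⊕ Y ⊝ (X ⊝ Y))
                                                     (y+y≡[x+y]-[x-y] (ℤ.+ x) (ℤ.+ y)) ⟩
        subM v (addM v x y) (subM v x y)        ≡⟨ cong (λ t → subM v t (subM v x y)) eq ⟩
        subM v (subM v x y) (subM v x y)        ≡⟨ subM-self v (⟦⟧< v (x<v xy∈S) (y<v xy∈S) (X ⊝ Y)) ⟩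
        0                                       ∎))
        where open ≡-Reasoning

      0≢5[x+x] : Distinct (0 , O) (0 , X ⊕ X)
      0≢5[x+x] = values-differ (≢-sym x+x≢0)
      2+5[x+y]≢2+5[x-y] : Distinct (2 , X ⊕ Y) (2 , X ⊝ Y)
      2+5[x+y]≢2+5[x-y] = values-differ x+y≢x-y

    codeword-valid : (length (codeword (x , y)) ≡ 5) × Unique (codeword (x , y)) × All (_< 5 * v) (codeword (x , y))
    codeword-valid = refl , codeword-Unique digits<5 distinct , codeword< digits<5
      where
      distinct : AllPairs Distinct shape
      distinct =
        (0≢5[x+x] ∷ digits-differ (λ ()) ∷ digits-differ (λ ()) ∷ digits-differ (λ ()) ∷ []) ∷
        (digits-differ (λ ()) ∷ digits-differ (λ ()) ∷ digits-differ (λ ()) ∷ []) ∷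
        (digits-differ (λ ()) ∷ digits-differ (λ ()) ∷ []) ∷
        (2+5[x+y]≢2+5[x-y] ∷ []) ∷ [] ∷ []

    multiples-of-5-doubled : All (λ a → 5 * addM v a a ∈ Δ (5 * v) code) (pmPair v (x , y))
    multiples-of-5-doubled =
      difference∈Δ s₁ s₀ (Distinct-sym 0≢5[x+x]) z≤n 0<5 (X ⊕ X) (sym (ℤₚ.+-identityʳ _)) ∷
      difference∈Δ s₀ s₁ 0≢5[x+x] z≤n 0<5 (⊝ X ⊕ ⊝ X) (-x+-x≡0-[x+x] (ℤ.+ x)) ∷
      difference∈Δ s₃ s₄ 2+5[x+y]≢2+5[x-y] ≤-refl 2<5 (Y ⊕ Y) (y+y≡[x+y]-[x-y] (ℤ.+ x) (ℤ.+ y)) ∷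
      difference∈Δ s₄ s₃ (Distinct-sym 2+5[x+y]≢2+5[x-y]) ≤-refl 2<5 (⊝ Y ⊕ ⊝ Y) (-y+-y≡[x-y]-[x+y] (ℤ.+ x) (ℤ.+ y)) ∷ []

    one-plus-multiples-of-5 : All (λ a → 1 + 5 * a ∈ Δ (5 * v) code) (pmPair v (x , y))
    one-plus-multiples-of-5 =
      difference∈Δ s₂ s₀ (digits-differ (λ ())) z≤n 1<5 X (sym (ℤₚ.+-identityʳ _)) ∷
      difference∈Δ s₂ s₁ (digits-differ (λ ())) z≤n 1<5 (⊝ X) (-x≡x-[x+x] (ℤ.+ x)) ∷
      difference∈Δ s₃ s₂ (digits-differ (λ ())) (s≤s z≤n) 2<5 Y (y≡[x+y]-x (ℤ.+ x) (ℤ.+ y)) ∷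
      difference∈Δ s₄ s₂ (digits-differ (λ ())) (s≤s z≤n) 2<5 (⊝ Y) (-y≡[x-y]-x (ℤ.+ x) (ℤ.+ y)) ∷ []

    two-plus-multiples-of-5 : All (λ a → 2 + 5 * a ∈ Δ (5 * v) code) (pmDiffSum v (x , y))
    two-plus-multiples-of-5 =
      difference∈Δ s₄ s₀ (digits-differ (λ ())) z≤n 2<5 (X ⊝ Y) (sym (ℤₚ.+-identityʳ _)) ∷
      difference∈Δ s₃ s₁ (digits-differ (λ ())) z≤n 2<5 (⊝ (X ⊝ Y)) (-[x-y]≡[x+y]-[x+x] (ℤ.+ x) (ℤ.+ y)) ∷
      difference∈Δ s₃ s₀ (digits-differ (λ ())) z≤n 2<5 (X ⊕ Y) (sym (ℤₚ.+-identityʳ _)) ∷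
      difference∈Δ s₄ s₁ (digits-differ (λ ())) z≤n 2<5 (⊝ (X ⊕ Y)) (-[x+y]≡[x-y]-[x+x] (ℤ.+ x) (ℤ.+ y)) ∷ []

  private
    M₀ M₊ M : List ℕ
    M₀ = 0 ∷ map (λ a → 5 * addM v a a) EA
    M₊ = forbidden 5 1 EA ++ forbidden 5 2 EB
    M  = M₀ ++ M₊ ++ map (negM (5 * v)) M₊

    code< : All (All (_< 5 * v)) code
    code< = map⁺ (All.tabulate (λ xy∈S → proj₂ (proj₂ (codeword-valid xy∈S))))

    -- 5q ∉ M₀ is covered through the half of q, which exists because v is odd.
    covers : ∀ z → z < 5 * v → z ∉ M → z ∈ Δ (5 * v) code
    covers = SymmetricCover.cover 2 v (_∈ Δ (5 * v) code) M₀ M₊ (λ _ → negM-∈-Δ (5 * v) code<) D₀ D₊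
      where
      D₀ : ∀ q → q < v → 5 * q ∉ M₀ → 5 * q ∈ Δ (5 * v) code
      D₀ q q<v 5q∉M₀ = subst (λ t → 5 * t ∈ Δ (5 * v) code) (addM-halve q<v)
        (covered-by-pairs (λ a → 5 * addM v a a ∈ Δ (5 * v) code) multiples-of-5-doubled
                          (halve q) (halve< q) h≢0 h∉EA)
        where
        h≢0 : halve q ≢ 0
        h≢0 h≡0 = 5q∉M₀ (here (cong (5 *_) (begin
          q                        ≡⟨ addM-halve q<v ⟨
          addM v (halve q) (halve q) ≡⟨ cong (λ h → addM v h h) h≡0 ⟩
          addM v 0 0               ≡⟨ addM-identityˡ v (≤-<-trans z≤n q<v) ⟩
          0                        ∎)))
          where open ≡-Reasoning
        h∉EA : halve q ∉ EA
        h∉EA h∈EA = 5q∉M₀ (there (subst (_∈ map (λ a → 5 * addM v a a) EA) (cong (5 *_) (addM-halve q<v))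
          (∈-map⁺ (λ a → 5 * addM v a a) h∈EA)))
      D₊ : ∀ r q → 0 < r → r ≤ 2 → q < v → r + 5 * q ∉ M₊ → r + 5 * q ∈ Δ (5 * v) code
      D₊ 1 q _ _ q<v z∉M₊ with q≢0 , q∉EA ← ∉-forbidden 5 1 (λ z∈ → z∉M₊ (∈-++⁺ˡ z∈)) =
        covered-by-pairs (λ a → 1 + 5 * a ∈ Δ (5 * v) code) one-plus-multiples-of-5 q q<v q≢0 q∉EA
      D₊ 2 q _ _ q<v z∉M₊ with q≢0 , q∉EB ← ∉-forbidden 5 2 (λ z∈ → z∉M₊ (∈-++⁺ʳ (forbidden 5 1 EA) z∈)) =
        covered-by-sums (λ a → 2 + 5 * a ∈ Δ (5 * v) code) two-plus-multiples-of-5 q q<v q≢0 q∉EB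
      D₊ (suc (suc (suc _))) _ _ (s≤s (s≤s ())) _ _

    length-M : length M ≡ 5 * (1 + 2 * δ)
    length-M = begin
      length M                                                    ≡⟨ length-++-++-map M₀ M₊ (negM (5 * v)) ⟩
      length M₀ + 2 * length M₊                                   ≡⟨ cong₂ (λ a b → suc a + 2 * b) (length-map _ EA)
                                                                                                 (length-++ (forbidden 5 1 EA)) ⟩
      suc (length EA) + 2 * (length (forbidden 5 1 EA) + length (forbidden 5 2 EB))
        ≡⟨ cong₂ (λ a b → suc (length EA) + 2 * (a + b)) (length-forbidden 5 1 EA) (length-forbidden 5 2 EB) ⟩
      suc (length EA) + 2 * (suc (length EA) + suc (length EB))   ≡⟨ cong₂ (λ a b → suc a + 2 * (suc a + suc b)) length-EA length-EB ⟩
      suc (2 * δ) + 2 * (suc (2 * δ) + suc (2 * δ))               ≡⟨ quintuple (2 * δ) ⟩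
      5 * (1 + 2 * δ)                                             ∎
      where
      open ≡-Reasoning
      quintuple : ∀ a → suc a + 2 * (suc a + suc a) ≡ 5 * (1 + a)
      quintuple = solve-∀

    |C|≡5 : All (λ C → length C ≡ 5) code
    |C|≡5 = map⁺ (All.tabulate (λ xy∈S → proj₁ (codeword-valid xy∈S)))

    |Δ|+|M|≤5v : length (Δ (5 * v) code) + length M ≤ 5 * v
    |Δ|+|M|≤5v = begin
      length (Δ (5 * v) code) + length M   ≤⟨ +-monoˡ-≤ (length M) (length-Δ (5 * v) 5 code |C|≡5) ⟩
      length code * 20 + length M          ≡⟨ cong₂ (λ s m → s * 20 + m) (length-map codeword S) length-M ⟩
      length S * 20 + 5 * (1 + 2 * δ)      ≡⟨ count (length S) δ ⟩
      5 * (1 + 2 * (2 * length S + δ))     ≡⟨ cong (5 *_) v≡1+2[2|S|+δ] ⟨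
      5 * v                                ∎
      where
      open ≤-Reasoning
      count : ∀ s d → s * 20 + 5 * (1 + 2 * d) ≡ 5 * (1 + 2 * (2 * s + d))
      count = solve-∀

  isMaxOOC : IsMaxOOC (5 * v) 5 code
  isMaxOOC = covering⇒IsMaxOOC (5 * v) 5 code M (map⁺ (All.tabulate codeword-valid)) covers |Δ|+|M|≤5v
    (≤-trans (≤-reflexive length-M) (≤-trans (*-monoʳ-≤ 5 (+-monoʳ-≤ 1 (*-monoʳ-≤ 2 δ≤1))) (m≤m+n 15 5)))

-- From PS and APS to pair systems

m%n≡r⇒m≡r+n*[[m∸r]/n] : ∀ m n .{{_ : NonZero n}} r → m % n ≡ r → m ≡ r + n * ((m ∸ r) / n)
m%n≡r⇒m≡r+n*[[m∸r]/n] m n r m%n≡r =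
  trans m≡r+[m/n]*n (cong (λ q → r + q) (trans (*-comm (m / n) n) (cong (n *_) (sym [m∸r]/n≡m/n))))
  where
  m≡r+[m/n]*n : m ≡ r + (m / n) * n
  m≡r+[m/n]*n = trans (m≡m%n+[m/n]*n m n) (cong (λ t → t + (m / n) * n) m%n≡r)
  [m∸r]/n≡m/n : (m ∸ r) / n ≡ m / n
  [m∸r]/n≡m/n = trans (cong (λ t → (t ∸ r) / n) m≡r+[m/n]*n) (trans (cong (_/ n) (m+n∸m≡n r _)) (m*n/n≡m (m / n) n))

private
  4s+1≡1+2[2s+0] : ∀ s → 1 + 4 * s ≡ 1 + 2 * (2 * s + 0)
  4s+1≡1+2[2s+0] = solve-∀
  4s+3≡1+2[2s+1] : ∀ s → 3 + 4 * s ≡ 1 + 2 * (2 * s + 1)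
  4s+3≡1+2[2s+1] = solve-∀

IsPS⇒PairSystem : ∀ {v S} → IsPS v S → PairSystem v S [] []
IsPS⇒PairSystem {v} {S} (v%4≡1 , |S|≡[v-1]/4 , pairs⇔ , sums⇔) = record
  { δ             = 0
  ; δ≤1           = z≤n
  ; v≡1+2[2|S|+δ] = trans (m%n≡r⇒m≡r+n*[[m∸r]/n] v 4 1 v%4≡1)
                      (trans (cong (λ s → 1 + 4 * s) (sym |S|≡[v-1]/4)) (4s+1≡1+2[2s+0] (length S)))
  ; length-EA     = refl
  ; length-EB     = refl
  ; pairs-sound   = λ q → Equivalence.to (pairs⇔ q)
  ; sums-sound    = λ q → Equivalence.to (sums⇔ q)
  ; pairs-cover   = λ q q<v q≢0 _ → Equivalence.from (pairs⇔ q) (q<v , q≢0)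
  ; sums-cover    = λ q q<v q≢0 _ → Equivalence.from (sums⇔ q) (q<v , q≢0)
  }

IsAPS⇒PairSystem : ∀ {v α β S} → IsAPS v α β S → PairSystem v S (α ∷ negM v α ∷ []) (β ∷ negM v β ∷ [])
IsAPS⇒PairSystem {v} {α} {β} {S} (v%4≡3 , _ , _ , _ , _ , |S|≡[v-3]/4 , pairs⇔ , sums⇔) = record
  { δ             = 1
  ; δ≤1           = ≤-refl
  ; v≡1+2[2|S|+δ] = trans (m%n≡r⇒m≡r+n*[[m∸r]/n] v 4 3 v%4≡3)
                      (trans (cong (λ s → 3 + 4 * s) (sym |S|≡[v-3]/4)) (4s+3≡1+2[2s+1] (length S)))
  ; length-EA     = refl
  ; length-EB     = refl
  ; pairs-sound   = λ q q∈ → sound (Equivalence.to (pairs⇔ q) q∈)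
  ; sums-sound    = λ q q∈ → sound (Equivalence.to (sums⇔ q) q∈)
  ; pairs-cover   = λ q q<v q≢0 q∉ → Equivalence.from (pairs⇔ q) (q<v , q≢0 , excluded q∉)
  ; sums-cover    = λ q q<v q≢0 q∉ → Equivalence.from (sums⇔ q) (q<v , q≢0 , excluded q∉)
  }
  where
  sound : ∀ {q γ} → q < v × q ≢ 0 × q ≢ γ × q ≢ negM v γ → q < v × q ≢ 0
  sound (q<v , q≢0 , _) = q<v , q≢0
  excluded : ∀ {q γ} → q ∉ γ ∷ negM v γ ∷ [] → q ≢ γ × q ≢ negM v γ
  excluded q∉ = (λ q≡γ → q∉ (here q≡γ)) , (λ q≡-γ → q∉ (there (here q≡-γ)))

toPairSystem : ∀ {v} → PS v ⊎ Σ ℕ (λ α → Σ ℕ (λ β → APS v α β)) → ∃ λ S → ∃₂ λ EA EB → PairSystem v S EA EB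
toPairSystem (inj₁ (S , ps))            = S , [] , [] , IsPS⇒PairSystem ps
toPairSystem (inj₂ (α , β , S , aps))   = S , _ , _ , IsAPS⇒PairSystem aps

theorem6p1 : (v : ℕ) →
    (PS v ⊎ Σ ℕ (λ α → Σ ℕ (λ β → APS v α β))) →
    ((gcd v 6 ≡ 1 → Σ (List (List ℕ)) (λ B → IsMaxOOC (3 * v) 4 B)) ×
     (gcd v 10 ≡ 1 → Σ (List (List ℕ)) (λ B → IsMaxOOC (5 * v) 5 B)))
theorem6p1 v system with S , EA , EB , P ← toPairSystem system =
  (λ _ → OOC-3v.code P , OOC-3v.isMaxOOC P) , (λ _ → OOC-5v.code P , OOC-5v.isMaxOOC P)
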